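{- For $n\geq 1$ let $$M(n)=\begin{pmatrix}s(n)&s(n+1)\\ t(n)&t(n+1)\end{pmatrix}.$$ Then $\det(M(n))=-2(-1)^k$ whenever $2^k\leq n<2^{k+1}$. In particular $|\det(M(n))|=2$ and $M(n)$ is invertible for all $n\geq 1$.
   Context: The Stern sequence $s$ is defined by $s(0)=0$, $s(1)=1$, $s(2n)=s(n)$, $s(2n+1)=s(n)+s(n+1)$ for $n\geq1$. The twisted Stern sequence $t$ is defined by $t(0)=0$, $t(1)=1$, $t(2n)=-t(n)$, $t(2n+1)=-t(n)-t(n+1)$ for $n\geq 1$. -}

module Defs where

open import Data.Nat using (ℕ; zero; suc)
open import Data.Nat.DivMod using (_/_; _%_)
open import Data.Fin using (Fin; zero; suc)
open import Data.Integer using (ℤ; +_; -_; _+_; _-_; _*_)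

-- Fuel-indexed evaluation of the Stern sequence; the fuel argument only
-- guarantees termination (fuel ≥ n suffices since n / 2 < n for n ≥ 1).
sternF : ℕ → ℕ → ℤ
sternF _ zero = + 0
sternF _ (suc zero) = + 1
sternF zero _ = + 0
sternF (suc f) n with n % 2
... | zero = sternF f (n / 2)
... | suc _ = sternF f (n / 2) + sternF f (suc (n / 2))

s : ℕ → ℤ
s n = sternF n n

twistF : ℕ → ℕ → ℤ
twistF _ zero = + 0
twistF _ (suc zero) = + 1
twistF zero _ = + 0
twistF (suc f) n with n % 2
... | zero = - twistF f (n / 2)
... | suc _ = - twistF f (n / 2) - twistF f (suc (n / 2))

t : ℕ → ℤ
t n = twistF n n

M : ℕ → Fin 2 → Fin 2 → ℤ
M n zero zero = s n
M n zero (suc zero) = s (suc n)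
M n (suc zero) zero = t n
M n (suc zero) (suc zero) = t (suc n)

det₂ : (Fin 2 → Fin 2 → ℤ) → ℤ
det₂ A = A zero zero * A (suc zero) (suc zero) - A zero (suc zero) * A (suc zero) zero

private
  open import Relation.Binary.PropositionalEquality using (_≡_; refl)
  _ : s 5 ≡ + 3
  _ = refl
  _ : t 5 ≡ + 1
  _ = refl
  _ : t 3 ≡ + 0
  _ = refl
  _ : det₂ (M 6) ≡ - (+ 2)
  _ = refl

-- The recurrences for s and t at 2m, 2m + 1 and 2m + 2 express the entries of M(2m) and
-- M(2m + 1) linearly in those of M(m), and both substitutions just flip the sign of the
-- determinant: det M(2m) = det M(2m + 1) = -det M(m) for m ≥ 1. So det M(n) = -det M(⌊n/2⌋);
-- halving n ∈ [2^k, 2^(k+1)) k times reaches det M(1) = -2 after k sign changes.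
module Submission where

open import Defs
open import Data.Nat using (ℕ; zero; suc; _≤_; _<_; _^_; z≤n; s≤s; NonZero; >-nonZero)
import Data.Nat as ℕ
open import Data.Nat.Properties using (≤-refl; n<1+n; ≤-trans; ≤-pred; *-comm; *-monoʳ-≤; m^n>0)
open import Data.Nat.DivMod
open import Data.Nat.Divisibility using (divides-refl)
open import Data.Nat.Induction using (<-rec)
open import Data.Integer using (+_; -_; _+_; _-_; _*_; ∣_∣)
import Data.Integer as ℤ
open import Data.Integer.Properties using (∣-i∣≡∣i∣)
open import Data.Integer.Tactic.RingSolver using (solve-∀)
open import Data.Product using (_×_; _,_)
open import Data.Sum using (_⊎_; inj₁; inj₂)
open import Relation.Binary.PropositionalEquality
open ≡-Reasoning

half-suc-suc : ∀ k → suc (suc k) / 2 ≡ suc (k / 2)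
half-suc-suc k = m/n≡1+[m∸n]/n {suc (suc k)} {2} (s≤s (s≤s z≤n))

half≤pred : ∀ k → suc (suc k) / 2 ≤ suc k
half≤pred k = ≤-pred (m/n<m (suc (suc k)) 2 (n<1+n 1))

-- For n = k + 2 odd we have k ≥ 1, which is what makes ⌊n/2⌋ + 1 < n.
suc-half≤pred : ∀ k {r} → suc (suc k) % 2 ≡ suc r → suc (suc (suc k) / 2) ≤ suc k
suc-half≤pred zero ()
suc-half≤pred (suc k) _ rewrite half-suc-suc (suc k) = s≤s (m/n<m (suc k) 2 (n<1+n 1))

sternF-fuel-irrelevant : ∀ f g n → n ≤ f → n ≤ g → sternF f n ≡ sternF g n
sternF-fuel-irrelevant _ _ zero _ _ = refl
sternF-fuel-irrelevant _ _ (suc zero) _ _ = refl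
sternF-fuel-irrelevant (suc f) (suc g) (suc (suc k)) (s≤s n≤f) (s≤s n≤g)
  with suc (suc k) % 2 in odd
... | zero  = sternF-fuel-irrelevant f g _ (≤-trans (half≤pred k) n≤f) (≤-trans (half≤pred k) n≤g)
... | suc _ = cong₂ _+_
  (sternF-fuel-irrelevant f g _ (≤-trans (half≤pred k) n≤f) (≤-trans (half≤pred k) n≤g))
  (sternF-fuel-irrelevant f g _ (≤-trans (suc-half≤pred k odd) n≤f) (≤-trans (suc-half≤pred k odd) n≤g))

twistF-fuel-irrelevant : ∀ f g n → n ≤ f → n ≤ g → twistF f n ≡ twistF g n
twistF-fuel-irrelevant _ _ zero _ _ = refl
twistF-fuel-irrelevant _ _ (suc zero) _ _ = refl
twistF-fuel-irrelevant (suc f) (suc g) (suc (suc k)) (s≤s n≤f) (s≤s n≤g)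
  with suc (suc k) % 2 in odd
... | zero  = cong -_ (twistF-fuel-irrelevant f g _ (≤-trans (half≤pred k) n≤f) (≤-trans (half≤pred k) n≤g))
... | suc _ = cong₂ _-_
  (cong -_ (twistF-fuel-irrelevant f g _ (≤-trans (half≤pred k) n≤f) (≤-trans (half≤pred k) n≤g)))
  (twistF-fuel-irrelevant f g _ (≤-trans (suc-half≤pred k odd) n≤f) (≤-trans (suc-half≤pred k odd) n≤g))

sternF≡s : ∀ {f} n → n ≤ f → sternF f n ≡ s n
sternF≡s n n≤f = sternF-fuel-irrelevant _ n n n≤f ≤-refl

twistF≡t : ∀ {f} n → n ≤ f → twistF f n ≡ t n
twistF≡t n n≤f = twistF-fuel-irrelevant _ n n n≤f ≤-refl

s-unfold-even : ∀ k → suc (suc k) % 2 ≡ 0 → s (suc (suc k)) ≡ s (suc (suc k) / 2)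
s-unfold-even k even rewrite even = sternF≡s _ (half≤pred k)

s-unfold-odd : ∀ k → suc (suc k) % 2 ≡ 1 →
               s (suc (suc k)) ≡ s (suc (suc k) / 2) + s (suc (suc (suc k) / 2))
s-unfold-odd k odd rewrite odd =
  cong₂ _+_ (sternF≡s _ (half≤pred k)) (sternF≡s _ (suc-half≤pred k odd))

t-unfold-even : ∀ k → suc (suc k) % 2 ≡ 0 → t (suc (suc k)) ≡ - t (suc (suc k) / 2)
t-unfold-even k even rewrite even = cong -_ (twistF≡t _ (half≤pred k))

t-unfold-odd : ∀ k → suc (suc k) % 2 ≡ 1 →
               t (suc (suc k)) ≡ - t (suc (suc k) / 2) - t (suc (suc (suc k) / 2))
t-unfold-odd k odd rewrite odd =
  cong₂ _-_ (cong -_ (twistF≡t _ (half≤pred k))) (twistF≡t _ (suc-half≤pred k odd))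

-- 2m is written m ℕ.* 2 because suc m ℕ.* 2 then reduces to suc (suc (m ℕ.* 2)), the shape the
-- unfolding lemmas above match.

[1+m*2]%2≡1 : ∀ m → suc (m ℕ.* 2) % 2 ≡ 1
[1+m*2]%2≡1 m = [m+kn]%n≡m%n 1 m 2

[1+m*2]/2≡m : ∀ m → suc (m ℕ.* 2) / 2 ≡ m
[1+m*2]/2≡m m = trans (+-distrib-/-∣ʳ 1 {d = 2} (divides-refl m)) (m*n/n≡m m 2)

s-double : ∀ m → s (m ℕ.* 2) ≡ s m
s-double zero = refl
s-double m@(suc j) = trans (s-unfold-even (j ℕ.* 2) (m*n%n≡0 m 2)) (cong s (m*n/n≡m m 2))

s-double+1 : ∀ m → s (suc (m ℕ.* 2)) ≡ s m + s (suc m)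
s-double+1 zero = refl
s-double+1 m@(suc j) = trans (s-unfold-odd (suc (j ℕ.* 2)) ([1+m*2]%2≡1 m))
  (cong (λ h → s h + s (suc h)) ([1+m*2]/2≡m m))

t-double : ∀ m → t (m ℕ.* 2) ≡ - t m
t-double zero = refl
t-double m@(suc j) = trans (t-unfold-even (j ℕ.* 2) (m*n%n≡0 m 2)) (cong (λ h → - t h) (m*n/n≡m m 2))

t-double+1 : ∀ m .{{_ : NonZero m}} → t (suc (m ℕ.* 2)) ≡ - t m - t (suc m)
t-double+1 m@(suc j) = trans (t-unfold-odd (suc (j ℕ.* 2)) ([1+m*2]%2≡1 m))
  (cong (λ h → - t h - t (suc h)) ([1+m*2]/2≡m m))

det-M-double : ∀ m → det₂ (M (m ℕ.* 2)) ≡ - det₂ (M m)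
det-M-double zero = refl
det-M-double m@(suc _) = begin
  s (m ℕ.* 2) * t (suc (m ℕ.* 2)) - s (suc (m ℕ.* 2)) * t (m ℕ.* 2)
    ≡⟨ cong₂ _-_ (cong₂ _*_ (s-double m) (t-double+1 m)) (cong₂ _*_ (s-double+1 m) (t-double m)) ⟩
  s m * (- t m - t (suc m)) - (s m + s (suc m)) * (- t m)
    ≡⟨ sign-change (s m) (s (suc m)) (t m) (t (suc m)) ⟩
  - det₂ (M m) ∎
  where
  sign-change : ∀ a b c d → a * (- c - d) - (a + b) * (- c) ≡ - (a * d - b * c)
  sign-change = solve-∀

det-M-double+1 : ∀ m .{{_ : NonZero m}} → det₂ (M (suc (m ℕ.* 2))) ≡ - det₂ (M m)
det-M-double+1 m = begin
  s (suc (m ℕ.* 2)) * t (suc m ℕ.* 2) - s (suc m ℕ.* 2) * t (suc (m ℕ.* 2))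
    ≡⟨ cong₂ _-_ (cong₂ _*_ (s-double+1 m) (t-double (suc m))) (cong₂ _*_ (s-double (suc m)) (t-double+1 m)) ⟩
  (s m + s (suc m)) * (- t (suc m)) - s (suc m) * (- t m - t (suc m))
    ≡⟨ sign-change (s m) (s (suc m)) (t m) (t (suc m)) ⟩
  - det₂ (M m) ∎
  where
  sign-change : ∀ a b c d → (a + b) * (- d) - b * (- c - d) ≡ - (a * d - b * c)
  sign-change = solve-∀

n≡[n/2]*2⊎1+[n/2]*2 : ∀ n → n ≡ n / 2 ℕ.* 2 ⊎ n ≡ suc (n / 2 ℕ.* 2)
n≡[n/2]*2⊎1+[n/2]*2 n with n % 2 | m≡m%n+[m/n]*n n 2 | m%n<n n 2
... | 0 | n≡ | _ = inj₁ n≡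
... | 1 | n≡ | _ = inj₂ n≡
... | suc (suc _) | _ | s≤s (s≤s ())

det-M-half : ∀ n → 2 ≤ n → det₂ (M n) ≡ - det₂ (M (n / 2))
det-M-half n 2≤n with n≡[n/2]*2⊎1+[n/2]*2 n
... | inj₁ n≡2m   = trans (cong (λ h → det₂ (M h)) n≡2m) (det-M-double (n / 2))
... | inj₂ n≡2m+1 = trans (cong (λ h → det₂ (M h)) n≡2m+1)
                          (det-M-double+1 (n / 2) {{>-nonZero (m≥n⇒m/n>0 2≤n)}})

det-M-dyadic : ∀ k n → 2 ^ k ≤ n → n < 2 ^ suc k → det₂ (M n) ≡ - (+ 2) * (- (+ 1)) ℤ.^ k
det-M-dyadic zero (suc zero) _ _ = refl
det-M-dyadic zero (suc (suc _)) _ (s≤s (s≤s ()))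
det-M-dyadic (suc k) n lower upper = begin
  det₂ (M n)                              ≡⟨ det-M-half n (≤-trans 2≤2^[1+k] lower) ⟩
  - det₂ (M (n / 2))                      ≡⟨ cong -_ (det-M-dyadic k (n / 2) half-lower half-upper) ⟩
  - (- (+ 2) * (- (+ 1)) ℤ.^ k)           ≡⟨ sign-change ((- (+ 1)) ℤ.^ k) ⟩
  - (+ 2) * (- (+ 1)) ℤ.^ suc k           ∎
  where
  2^[1+j]≡2^j*2 : ∀ j → 2 ^ suc j ≡ 2 ^ j ℕ.* 2
  2^[1+j]≡2^j*2 j = *-comm 2 (2 ^ j)
  2≤2^[1+k] : 2 ≤ 2 ^ suc k
  2≤2^[1+k] = *-monoʳ-≤ 2 (m^n>0 2 k)
  half-lower : 2 ^ k ≤ n / 2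
  half-lower = subst (_≤ n / 2) (m*n/n≡m (2 ^ k) 2)
    (/-monoˡ-≤ 2 (subst (_≤ n) (2^[1+j]≡2^j*2 k) lower))
  half-upper : n / 2 < 2 ^ suc k
  half-upper = m<n*o⇒m/o<n (subst (n <_) (2^[1+j]≡2^j*2 (suc k)) upper)
  sign-change : ∀ x → - (- (+ 2) * x) ≡ - (+ 2) * (- (+ 1) * x)
  sign-change = solve-∀

∣det-M∣≡2 : ∀ n → 1 ≤ n → ∣ det₂ (M n) ∣ ≡ 2
∣det-M∣≡2 = <-rec (λ n → 1 ≤ n → ∣ det₂ (M n) ∣ ≡ 2) step
  where
  step : ∀ n → (∀ {m} → m < n → 1 ≤ m → ∣ det₂ (M m) ∣ ≡ 2) → 1 ≤ n → ∣ det₂ (M n) ∣ ≡ 2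
  step (suc zero) _ _ = refl
  step n@(suc (suc _)) rec _ = begin
    ∣ det₂ (M n) ∣             ≡⟨ cong ∣_∣ (det-M-half n (s≤s (s≤s z≤n))) ⟩
    ∣ - det₂ (M (n / 2)) ∣     ≡⟨ ∣-i∣≡∣i∣ (det₂ (M (n / 2))) ⟩
    ∣ det₂ (M (n / 2)) ∣       ≡⟨ rec (m/n<m n 2 (n<1+n 1)) (m≥n⇒m/n>0 {n} {2} (s≤s (s≤s z≤n))) ⟩
    2                          ∎

∣i∣≡2⇒i≢0 : ∀ {i} → ∣ i ∣ ≡ 2 → i ≢ + 0
∣i∣≡2⇒i≢0 () refl

mainTheorem7 : (∀ (n k : ℕ) → 2 ^ k ≤ n → n < 2 ^ suc k →
                 det₂ (M n) ≡ - (+ 2) * (- (+ 1)) ℤ.^ k)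
               × (∀ (n : ℕ) → 1 ≤ n → ∣ det₂ (M n) ∣ ≡ 2 × det₂ (M n) ≢ + 0)
mainTheorem7 = (λ n k → det-M-dyadic k n)
             , λ n 1≤n → ∣det-M∣≡2 n 1≤n , ∣i∣≡2⇒i≢0 (∣det-M∣≡2 n 1≤n)
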